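{- Let $\mathcal{G}$ be a connected RCOP block graph and let $u_1\leftrightarrow u_s$ be the shortest path, passing through $u_1,u_2,\dots,u_s$ in this order, between two vertices with $\lambda(u_1)=\lambda(u_s)$. Then the sequence of edge colors $\lambda(\{u_1,u_2\}),\lambda(\{u_2,u_3\}),\dots,\lambda(\{u_{s-1},u_s\})$ and the sequence of vertex colors $\lambda(u_1),\lambda(u_2),\dots,\lambda(u_s)$ are both symmetric (palindromic).
   Context: A colored graph $\mathcal{G}$ is a finite simple undirected graph on vertex set $[n]$ with a coloring $\lambda$ of its vertices and edges; $\Gamma(\mathcal{G})$ is the group of graph automorphisms preserving all vertex and edge colors. $\mathcal{G}$ is RCOP if the vertex colors and edge colors form disjoint sets, any two same-colored vertices are mapped to one another by some element of $\Gamma(\mathcal{G})$, and any two same-colored edges are mapped to one another by some element of $\Gamma(\mathcal{G})$. A graph on $[n]$ is a block graph if there is a vertex $c$ and a partition of $[n]$ into disjoint sets $A,B,\{c\}$ such that every path from $A$ to $B$ contains $c$, and the induced subgraphs on $A\cup\{c\}$ and $B\cup\{c\}$ are each complete graphs or block graphs. In a connected block graph any two vertices $u,v$ are joined by a unique shortest path, denoted $u\leftrightarrow v$. -}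

module Defs where

open import Data.Nat using (ℕ; _≤_)
open import Data.Bool using (Bool; true; false)
open import Data.Fin using (Fin)
open import Data.Fin.Subset using (Subset; _∈_; _∉_; _∪_; ⁅_⁆; ⊤)
open import Data.Fin.Permutation using (Permutation′; _⟨$⟩ʳ_)
open import Data.List using (List; []; _∷_; map; reverse; length)
open import Data.List.Relation.Unary.All using (All)
import Data.List.Membership.Propositional as LMem
open import Data.Product using (Σ; ∃; _×_; _,_)
open import Data.Sum using (_⊎_)
open import Data.Empty using (⊥)
open import Relation.Nullary using (¬_)
open import Relation.Binary.PropositionalEquality using (_≡_; _≢_)

-- A colored finite simple undirected graph on vertex set Fin n.
-- Colors live in ℕ; the edge coloring is a symmetric function on pairs whose
-- values are only meaningful on edges (adjacent pairs).
record ColoredGraph (n : ℕ) : Set where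
  field
    adj      : Fin n → Fin n → Bool
    adj-sym  : ∀ u v → adj u v ≡ adj v u
    adj-irr  : ∀ u → adj u u ≡ false
    vcol     : Fin n → ℕ
    ecol     : Fin n → Fin n → ℕ
    ecol-sym : ∀ u v → ecol u v ≡ ecol v u

open ColoredGraph public

module _ {n : ℕ} (G : ColoredGraph n) where

  Adj : Fin n → Fin n → Set
  Adj u v = adj G u v ≡ true

  IsWalk : List (Fin n) → Set
  IsWalk []                = ⊤'
    where open import Data.Unit using () renaming (⊤ to ⊤')
  IsWalk (x ∷ [])          = ⊤'
    where open import Data.Unit using () renaming (⊤ to ⊤')
  IsWalk (x ∷ y ∷ xs)      = Adj x y × IsWalk (y ∷ xs)

  lastOf : Fin n → List (Fin n) → Fin n
  lastOf x []       = x
  lastOf x (y ∷ ys) = lastOf y ys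

  WalkFromTo : Fin n → Fin n → List (Fin n) → Set
  WalkFromTo u v rest = IsWalk (u ∷ rest) × lastOf u rest ≡ v

  IsShortestPath : Fin n → Fin n → List (Fin n) → Set
  IsShortestPath u v rest =
    WalkFromTo u v rest × (∀ rest' → WalkFromTo u v rest' → length rest ≤ length rest')

  Connected : Set
  Connected = ∀ u v → ∃ λ rest → WalkFromTo u v rest

  CompleteOn : Subset n → Set
  CompleteOn S = ∀ u v → u ∈ S → v ∈ S → u ≢ v → Adj u v

  -- Block graphs (inductive reading of the recursive definition), on the induced
  -- subgraph of G on the vertex set S.
  data BlockOn : Subset n → Set where
    block : (S A B : Subset n) (c : Fin n) →
      (∀ x → x ∈ S → (x ∈ A ⊎ x ∈ B ⊎ x ≡ c)) →
      (∀ x → x ∈ A → x ∈ S) → (∀ x → x ∈ B → x ∈ S) → c ∈ S →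
      c ∉ A → c ∉ B → (∀ x → x ∈ A → x ∉ B) →
      (∀ a rest → a ∈ A → All (_∈ S) (a ∷ rest) → IsWalk (a ∷ rest) →
         lastOf a rest ∈ B → LMem._∈_ c (a ∷ rest)) →
      (CompleteOn (A ∪ ⁅ c ⁆) ⊎ BlockOn (A ∪ ⁅ c ⁆)) →
      (CompleteOn (B ∪ ⁅ c ⁆) ⊎ BlockOn (B ∪ ⁅ c ⁆)) →
      BlockOn S

  IsBlockGraph : Set
  IsBlockGraph = BlockOn ⊤

  IsAut : Permutation′ n → Set
  IsAut σ =
    (∀ u v → adj G (σ ⟨$⟩ʳ u) (σ ⟨$⟩ʳ v) ≡ adj G u v) ×
    (∀ u → vcol G (σ ⟨$⟩ʳ u) ≡ vcol G u) ×
    (∀ u v → Adj u v → ecol G (σ ⟨$⟩ʳ u) (σ ⟨$⟩ʳ v) ≡ ecol G u v)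

  IsRCOP : Set
  IsRCOP =
    (∀ w u v → Adj u v → vcol G w ≢ ecol G u v) ×
    (∀ u v → vcol G u ≡ vcol G v → Σ (Permutation′ n) λ σ → IsAut σ × σ ⟨$⟩ʳ u ≡ v) ×
    (∀ u v w x → Adj u v → Adj w x → ecol G u v ≡ ecol G w x →
       Σ (Permutation′ n) λ σ → IsAut σ ×
         ((σ ⟨$⟩ʳ u ≡ w × σ ⟨$⟩ʳ v ≡ x) ⊎ (σ ⟨$⟩ʳ u ≡ x × σ ⟨$⟩ʳ v ≡ w)))

  edgeColors : List (Fin n) → List ℕ
  edgeColors []           = []
  edgeColors (x ∷ [])     = []
  edgeColors (x ∷ y ∷ xs) = ecol G x y ∷ edgeColors (y ∷ xs)

  vertexColors : List (Fin n) → List ℕ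
  vertexColors = map (vcol G)

Palindrome : List ℕ → Set
Palindrome xs = reverse xs ≡ xs

-- Let σ be an automorphism with σ u = v and write p 0, …, p D for the shortest path, so p D = σ (p 0).
-- In a block graph every 4-cycle has a chord, and no closed walk is locally geodesic (each w i, w (i + 2)
-- distinct and non-adjacent); by finiteness no infinite walk is locally geodesic either. If σ (p 1) ≠ p (D - 1),
-- then either p (D - 1), p D, σ (p 1) is geodesic and p, σ p, σ² p, … concatenate to an infinite locally geodesic
-- walk, or p (D - 1), p D, σ (p 1) is a triangle and the segments p 1 … p (D - 1), σ (p 1) … σ (p (D - 1)), …
-- do, the chords keeping the junctions geodesic. So σ (p 1) = p (D - 1), and induction on the inner path gives
-- σ (p i) = p (D - i); as σ preserves colours, both colour sequences are palindromes.
module Submission where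

open import Defs
open import Data.Bool using (true)
open import Data.Bool.Properties using () renaming (_≟_ to _≟ᵇ_)
open import Data.Empty using (⊥; ⊥-elim)
open import Data.Fin using (Fin; toℕ)
import Data.Fin.Properties as Fin
open import Data.Fin.Permutation using (Permutation′; _⟨$⟩ʳ_; _⟨$⟩ˡ_; inverseˡ)
open import Data.Fin.Subset using (Subset; _∈_; _∉_; _∪_; ⁅_⁆)
open import Data.Fin.Subset.Properties using (x∈p∪q⁺; x∈⁅x⁆; ∈⊤; _∈?_)
open import Data.List using (List; []; _∷_; applyUpTo; applyDownFrom; reverse; length; map)
open import Data.List.Properties using (reverse-applyUpTo; map-applyUpTo)
open import Data.List.Membership.Propositional.Properties using (∈-applyUpTo⁻)
open import Data.List.Relation.Unary.All using (All; []; _∷_)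
open import Data.List.Relation.Unary.All.Properties using (applyUpTo⁺₁)
open import Data.List.Relation.Unary.Any using (here; there)
import Data.List.Membership.Propositional as List
open import Data.Nat using (ℕ; zero; suc; _+_; _∸_; _≤_; _<_; z≤n; s≤s; s≤s⁻¹; z<s; s<s; NonZero; >-nonZero⁻¹)
open import Data.Nat.DivMod using (_/_; _%_; m/n≡1+[m∸n]/n; [m+n]%n≡m%n; m<n⇒m/n≡0; m<n⇒m%n≡m)
open import Data.Nat.GeneralisedArithmetic using (fold)
open import Data.Nat.Induction using (<-rec)
open import Data.Nat.Properties
open import Data.Product using (∃; ∃₂; _×_; _,_; proj₁; proj₂)
open import Data.Sum using (_⊎_; inj₁; inj₂)
open import Data.Unit using (tt)
open import Function using (_∘_)
open import Relation.Binary.Definitions using (tri<; tri≈; tri>)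
open import Relation.Nullary using (¬_; Dec; yes; no)
open import Relation.Binary.PropositionalEquality

module _ {a} {A : Set a} where

  applyUpTo-cong : ∀ {f g : ℕ → A} n → (∀ {i} → i < n → f i ≡ g i) → applyUpTo f n ≡ applyUpTo g n
  applyUpTo-cong zero    f≗g = refl
  applyUpTo-cong (suc n) f≗g = cong₂ _∷_ (f≗g z<s) (applyUpTo-cong n (f≗g ∘ s<s))

  applyDownFrom-as-applyUpTo : ∀ (f : ℕ → A) n → applyDownFrom f n ≡ applyUpTo (λ i → f (n ∸ suc i)) n
  applyDownFrom-as-applyUpTo f zero    = refl
  applyDownFrom-as-applyUpTo f (suc n) = cong (f n ∷_) (applyDownFrom-as-applyUpTo f n)

  mirror-involutive : ∀ {n i} → i < n → n ∸ suc (n ∸ suc i) ≡ i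
  mirror-involutive {suc n} (s≤s i≤n) = m∸[m∸n]≡n i≤n

  mirror-from-lower-half : ∀ (h : ℕ → A) n → (∀ {i} → i < n ∸ suc i → h (n ∸ suc i) ≡ h i) →
                           ∀ {i} → i < n → h (n ∸ suc i) ≡ h i
  mirror-from-lower-half h n half {i} i<n with <-cmp i (n ∸ suc i)
  ... | tri< i<j _ _ = half i<j
  ... | tri≈ _ i≡j _ = cong h (sym i≡j)
  ... | tri> _ _ j<i = sym (trans (cong h (sym j′≡i)) (half (subst (n ∸ suc i <_) (sym j′≡i) j<i)))
    where j′≡i = mirror-involutive i<n

  applyUpTo-palindrome : ∀ (f : ℕ → A) n → (∀ {i} → i < n ∸ suc i → f (n ∸ suc i) ≡ f i) →
                         reverse (applyUpTo f n) ≡ applyUpTo f n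
  applyUpTo-palindrome f n half = begin
    reverse (applyUpTo f n)            ≡⟨ reverse-applyUpTo f n ⟩
    applyDownFrom f n                  ≡⟨ applyDownFrom-as-applyUpTo f n ⟩
    applyUpTo (λ i → f (n ∸ suc i)) n  ≡⟨ applyUpTo-cong n (mirror-from-lower-half f n half) ⟩
    applyUpTo f n                      ∎
    where open ≡-Reasoning

m<o∸n⇒m+n<o : ∀ {m n o} → m < o ∸ n → m + n < o
m<o∸n⇒m+n<o {m} {n} {o} m<o∸n = m≤o∸n⇒m+n≤o (suc m) n≤o m<o∸n
  where n≤o = <⇒≤ (m∸n≢0⇒n<m (m<n⇒n≢0 m<o∸n))

swap-first-two : ∀ {a b c} {P : Set a} {Q : Set b} {R : Set c} → P ⊎ Q ⊎ R → Q ⊎ P ⊎ R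
swap-first-two (inj₁ p)        = inj₂ (inj₁ p)
swap-first-two (inj₂ (inj₁ q)) = inj₁ q
swap-first-two (inj₂ (inj₂ r)) = inj₂ (inj₂ r)

module _ {n : ℕ} (G : ColoredGraph n) where

  private
    V = Fin n

  Adj-sym : ∀ {x y} → Adj G x y → Adj G y x
  Adj-sym {x} {y} xy = trans (adj-sym G y x) xy

  Adj-irrefl : ∀ {x} → ¬ Adj G x x
  Adj-irrefl {x} xx with () ← trans (sym (adj-irr G x)) xx

  Dist≥2 : V → V → Set
  Dist≥2 x y = x ≢ y × ¬ Adj G x y

  Dist≥2-sym : ∀ {x y} → Dist≥2 x y → Dist≥2 y x
  Dist≥2-sym (x≢y , ¬xy) = x≢y ∘ sym , ¬xy ∘ Adj-sym

  Adj? : ∀ x y → Dec (Adj G x y)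
  Adj? x y = adj G x y ≟ᵇ true

  -- Walks are sequences w 0, …, w m; only their values up to position m matter.
  Walk : (ℕ → V) → ℕ → Set
  Walk w m = ∀ {i} → i < m → Adj G (w i) (w (suc i))

  Within : Subset n → (ℕ → V) → ℕ → Set
  Within S w m = ∀ {i} → i ≤ m → w i ∈ S

  -- In a block graph these are exactly the shortest paths.
  record LocallyGeodesic (w : ℕ → V) (m : ℕ) : Set where
    field
      walk        : Walk w m
      no-shortcut : ∀ {i} → 2 + i ≤ m → Dist≥2 (w i) (w (2 + i))
  open LocallyGeodesic

  Walk-drop : ∀ k {w m l} → k + l ≤ m → Walk w m → Walk (λ t → w (k + t)) l
  Walk-drop zero    k+l≤m walk = walk ∘ λ i<l → <-≤-trans i<l k+l≤m
  Walk-drop (suc k) {m = suc m} (s≤s k+l≤m) walk = Walk-drop k k+l≤m (walk ∘ s≤s)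

  Within-drop : ∀ k {S w m l} → k + l ≤ m → Within S w m → Within S (λ t → w (k + t)) l
  Within-drop zero    k+l≤m within = within ∘ λ i≤l → ≤-trans i≤l k+l≤m
  Within-drop (suc k) {m = suc m} (s≤s k+l≤m) within = Within-drop k k+l≤m (within ∘ s≤s)

  LocallyGeodesic-drop : ∀ k {w m l} → k + l ≤ m → LocallyGeodesic w m → LocallyGeodesic (λ t → w (k + t)) l
  LocallyGeodesic-drop zero    k+l≤m lg = record
    { walk = walk lg ∘ λ i<l → <-≤-trans i<l k+l≤m
    ; no-shortcut = no-shortcut lg ∘ λ 2+i≤l → ≤-trans 2+i≤l k+l≤m
    }
  LocallyGeodesic-drop (suc k) {m = suc m} (s≤s k+l≤m) lg = LocallyGeodesic-drop k k+l≤m record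
    { walk = walk lg ∘ s≤s
    ; no-shortcut = no-shortcut lg ∘ s≤s
    }

  Walk-reverse : ∀ {w m} → Walk w m → Walk (λ t → w (m ∸ t)) m
  Walk-reverse {w} {m} walk {i} i<m = Adj-sym (subst (Adj G (w (m ∸ suc i)) ∘ w) m∸i≡1+m∸1+i
    (walk (∸-monoʳ-< z<s i<m)))
    where m∸i≡1+m∸1+i = sym (+-∸-assoc 1 i<m)

  Within-reverse : ∀ {S w m} → Within S w m → Within S (λ t → w (m ∸ t)) m
  Within-reverse {m = m} within {i} _ = within (m∸n≤m m i)

  IsWalk-applyUpTo : ∀ w m → Walk w m → IsWalk G (applyUpTo w (suc m))
  IsWalk-applyUpTo w zero    walk = tt
  IsWalk-applyUpTo w (suc m) walk = walk z<s , IsWalk-applyUpTo (w ∘ suc) m (walk ∘ s<s)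

  lastOf-applyUpTo : ∀ w m → lastOf G (w 0) (applyUpTo (w ∘ suc) m) ≡ w m
  lastOf-applyUpTo w zero    = refl
  lastOf-applyUpTo w (suc m) = lastOf-applyUpTo (w ∘ suc) m

  GeodesicStep : (ℕ → V) → ℕ → Set
  GeodesicStep w i = Adj G (w i) (w (suc i)) × Dist≥2 (w i) (w (2 + i))

  GeodesicStep-from : ∀ w i {x y z} → w i ≡ x → w (suc i) ≡ y → w (2 + i) ≡ z →
                      Adj G x y × Dist≥2 x z → GeodesicStep w i
  GeodesicStep-from w i refl refl refl step = step

  geodesic-step : ∀ {w m i} → LocallyGeodesic w m → 2 + i ≤ m → GeodesicStep w i
  geodesic-step lg 2+i≤m = walk lg (≤-trans (n≤1+n _) 2+i≤m) , no-shortcut lg 2+i≤m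

  everywhere-geodesic : ∀ {w} → (∀ i → GeodesicStep w i) → ∀ m → LocallyGeodesic w m
  everywhere-geodesic steps m = record
    { walk        = λ {i} _ → proj₁ (steps i)
    ; no-shortcut = λ {i} _ → proj₂ (steps i)
    }

  walkVertex : V → List V → ℕ → V
  walkVertex x xs       zero    = x
  walkVertex x []       (suc i) = x
  walkVertex x (y ∷ ys) (suc i) = walkVertex y ys i

  applyUpTo-walkVertex : ∀ x xs → x ∷ xs ≡ applyUpTo (walkVertex x xs) (suc (length xs))
  applyUpTo-walkVertex x []       = refl
  applyUpTo-walkVertex x (y ∷ ys) = cong (x ∷_) (applyUpTo-walkVertex y ys)

  lastOf-walkVertex : ∀ x xs → lastOf G x xs ≡ walkVertex x xs (length xs)
  lastOf-walkVertex x []       = refl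
  lastOf-walkVertex x (y ∷ ys) = lastOf-walkVertex y ys

  Walk-walkVertex : ∀ x xs → IsWalk G (x ∷ xs) → Walk (walkVertex x xs) (length xs)
  Walk-walkVertex x (y ∷ ys) (xy , _)    {zero}  _         = xy
  Walk-walkVertex x (y ∷ ys) (_ , walk) {suc i} (s≤s i<l) = Walk-walkVertex y ys walk i<l

  shortcut : ∀ x xs {i} → IsWalk G (x ∷ xs) → 2 + i ≤ length xs →
             walkVertex x xs i ≡ walkVertex x xs (2 + i) ⊎ Adj G (walkVertex x xs i) (walkVertex x xs (2 + i)) →
             ∃ λ ys → WalkFromTo G x (lastOf G x xs) ys × length ys < length xs
  shortcut x (y ∷ z ∷ zs) {zero}  (_ , _ , walk) _ (inj₁ refl) = zs , (walk , refl) , n≤1+n _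
  shortcut x (y ∷ z ∷ zs) {zero}  (_ , _ , walk) _ (inj₂ xz)   = z ∷ zs , ((xz , walk) , refl) , ≤-refl
  shortcut x (y ∷ ys)     {suc i} (xy , walk) (s≤s 2+i≤l) shortcutting
    with zs , (walk′ , last′) , shorter ← shortcut y ys walk 2+i≤l shortcutting
    = y ∷ zs , ((xy , walk′) , last′) , s≤s shorter

  shortest⇒geodesic : ∀ {u v rest} → IsShortestPath G u v rest → LocallyGeodesic (walkVertex u rest) (length rest)
  shortest⇒geodesic {u} {v} {rest} ((walk , last) , shortest) = record
    { walk        = Walk-walkVertex u rest walk
    ; no-shortcut = λ 2+i≤l → no-shortcut-of (shortcut u rest walk 2+i≤l ∘ inj₁) ,
                              no-shortcut-of (shortcut u rest walk 2+i≤l ∘ inj₂)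
    }
    where
    no-shortcut-of : ∀ {P : Set} → (P → ∃ λ ys → WalkFromTo G u (lastOf G u rest) ys × length ys < length rest) → ¬ P
    no-shortcut-of shortcutting p with ys , (walk′ , last′) , shorter ← shortcutting p
      = ≤⇒≯ (shortest ys (walk′ , trans last′ last)) shorter

  edgeColors-applyUpTo : ∀ f m → edgeColors G (applyUpTo f (suc m)) ≡ applyUpTo (λ i → ecol G (f i) (f (suc i))) m
  edgeColors-applyUpTo f zero    = refl
  edgeColors-applyUpTo f (suc m) = cong (ecol G (f 0) (f 1) ∷_) (edgeColors-applyUpTo (f ∘ suc) m)

  Separates : Subset n → Subset n → Subset n → V → Set
  Separates S A B k = ∀ a rest → a ∈ A → All (_∈ S) (a ∷ rest) → IsWalk G (a ∷ rest) →
                      lastOf G a rest ∈ B → k List.∈ (a ∷ rest)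

  NoClosedGeodesic : Subset n → ℕ → Set
  NoClosedGeodesic S m = ∀ {w} → 0 < m → Within S w m → LocallyGeodesic w m → w 0 ≢ w m

  closed-segment : ∀ {S w m x y} → Within S w m → LocallyGeodesic w m → x < y → y ≤ m →
                   NoClosedGeodesic S (y ∸ x) → w x ≢ w y
  closed-segment {w = w} {m} {x} {y} within lg x<y y≤m no-closed wx≡wy =
    no-closed (m<n⇒0<n∸m x<y) (Within-drop x x+l≤m within) (LocallyGeodesic-drop x x+l≤m lg)
      (trans (cong w (+-identityʳ x)) (trans wx≡wy (cong w (sym x+l≡y))))
    where
    x+l≡y = m+[n∸m]≡n (<⇒≤ x<y)
    x+l≤m = subst (_≤ m) (sym x+l≡y) y≤m

  complete⇒no-closed-geodesic : ∀ {S} → CompleteOn G S → ∀ m → NoClosedGeodesic S m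
  complete⇒no-closed-geodesic K 1 {w} _ _ lg w0≡w1 =
    Adj-irrefl (subst (Adj G (w 0)) (sym w0≡w1) (walk lg z<s))
  complete⇒no-closed-geodesic K (suc (suc m)) _ within lg _ =
    proj₂ far (K _ _ (within z≤n) (within (s≤s (s≤s z≤n))) (proj₁ far))
    where far = no-shortcut lg (s≤s (s≤s z≤n))

  ∈-∪⁅⁆ : ∀ {X : Subset n} {k x} → x ∈ X ⊎ x ≡ k → x ∈ X ∪ ⁅ k ⁆
  ∈-∪⁅⁆         (inj₁ x∈X) = x∈p∪q⁺ (inj₁ x∈X)
  ∈-∪⁅⁆ {k = k} (inj₂ refl) = x∈p∪q⁺ (inj₂ (x∈⁅x⁆ k))

  FourCycle : V → V → V → V → Set
  FourCycle a b c d = Adj G a b × Adj G b c × Adj G c d × Adj G d a × a ≢ c × b ≢ d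

  HasFourCycleChords : Subset n → Set
  HasFourCycleChords S = ∀ {a b c d} → a ∈ S → b ∈ S → c ∈ S → d ∈ S → FourCycle a b c d → Adj G a c

  common-neighbour-on-side : ∀ {X Y : Subset n} {k x y z} → (∀ {u v} → u ∈ X → v ∈ Y → ¬ Adj G u v) →
    x ∈ X ⊎ x ≡ k → y ∈ X ⊎ y ≡ k → x ≢ y → z ∈ X ⊎ z ∈ Y ⊎ z ≡ k →
    Adj G x z → Adj G z y → z ∈ X ∪ ⁅ k ⁆
  common-neighbour-on-side _ _ _ _ (inj₁ z∈X)        _ _ = ∈-∪⁅⁆ (inj₁ z∈X)
  common-neighbour-on-side _ _ _ _ (inj₂ (inj₂ z≡k)) _ _ = ∈-∪⁅⁆ (inj₂ z≡k)
  common-neighbour-on-side no-edge (inj₁ x∈X) _ _ (inj₂ (inj₁ z∈Y)) xz _ = ⊥-elim (no-edge x∈X z∈Y xz)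
  common-neighbour-on-side no-edge (inj₂ _) (inj₁ y∈X) _ (inj₂ (inj₁ z∈Y)) _ zy =
    ⊥-elim (no-edge y∈X z∈Y (Adj-sym zy))
  common-neighbour-on-side _ (inj₂ x≡k) (inj₂ y≡k) x≢y (inj₂ (inj₁ _)) _ _ = ⊥-elim (x≢y (trans x≡k (sym y≡k)))

  module Separated {S A B : Subset n} {k : V} (cover : ∀ x → x ∈ S → x ∈ A ⊎ x ∈ B ⊎ x ≡ k)
                   (A⊆S : ∀ x → x ∈ A → x ∈ S) (B⊆S : ∀ x → x ∈ B → x ∈ S)
                   (k∉A : k ∉ A) (k∉B : k ∉ B) (sep : Separates S A B k) where

    Crossing : V → V → Set
    Crossing x y = (x ∈ A × y ∈ B) ⊎ (x ∈ B × y ∈ A)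

    Crossing-sym : ∀ {x y} → Crossing x y → Crossing y x
    Crossing-sym (inj₁ (x∈A , y∈B)) = inj₂ (y∈B , x∈A)
    Crossing-sym (inj₂ (x∈B , y∈A)) = inj₁ (y∈A , x∈B)

    cut-forward : ∀ {w m} → Walk w m → Within S w m → w 0 ∈ A → w m ∈ B → ∃ λ x → 0 < x × x < m × w x ≡ k
    cut-forward {w} {m} walk within w0∈A wm∈B = interior (∈-applyUpTo⁻ w k∈walk)
      where
      k∈walk = sep (w 0) (applyUpTo (w ∘ suc) m) w0∈A (applyUpTo⁺₁ w (suc m) (within ∘ s≤s⁻¹))
                   (IsWalk-applyUpTo w m walk) (subst (_∈ B) (sym (lastOf-applyUpTo w m)) wm∈B)
      interior : (∃ λ x → x < suc m × k ≡ w x) → ∃ λ x → 0 < x × x < m × w x ≡ k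
      interior (x , x<1+m , k≡wx) = x , n≢0⇒n>0 x≢0 , ≤∧≢⇒< (s≤s⁻¹ x<1+m) x≢m , sym k≡wx
        where
        x≢0 : x ≢ 0
        x≢0 refl = k∉A (subst (_∈ A) (sym k≡wx) w0∈A)
        x≢m : x ≢ m
        x≢m refl = k∉B (subst (_∈ B) (sym k≡wx) wm∈B)

    cut : ∀ {w m} → Walk w m → Within S w m → Crossing (w 0) (w m) → ∃ λ x → 0 < x × x < m × w x ≡ k
    cut walk within (inj₁ (w0∈A , wm∈B)) = cut-forward walk within w0∈A wm∈B
    cut {w} {m} walk within (inj₂ (w0∈B , wm∈A))
      with x , 0<x , x<m , wx≡k ← cut-forward (Walk-reverse walk) (Within-reverse within)
                                   wm∈A (subst (λ t → w t ∈ B) (sym (n∸n≡0 m)) w0∈B)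
      = m ∸ x , m<n⇒0<n∸m x<m , ∸-monoʳ-< 0<x (<⇒≤ x<m) , wx≡k

    cut-between : ∀ {w m a b} → Walk w m → Within S w m → a ≤ b → b ≤ m → Crossing (w a) (w b) →
                  ∃ λ x → a < x × x < b × w x ≡ k
    cut-between {w} {m} {a} {b} walk within a≤b b≤m crossing =
      shift (cut (Walk-drop a a+l≤m walk) (Within-drop a a+l≤m within) crossing′)
      where
      a+l≡b = m+[n∸m]≡n a≤b
      a+l≤m = subst (_≤ m) (sym a+l≡b) b≤m
      crossing′ : Crossing (w (a + 0)) (w (a + (b ∸ a)))
      crossing′ = subst₂ (λ s t → Crossing (w s) (w t)) (sym (+-identityʳ a)) (sym a+l≡b) crossing
      shift : (∃ λ x → 0 < x × x < b ∸ a × w (a + x) ≡ k) → ∃ λ x → a < x × x < b × w x ≡ k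
      shift (x , 0<x , x<b∸a , wx≡k) = a + x , m<m+n a 0<x , subst (a + x <_) a+l≡b (+-monoʳ-< a x<b∸a) , wx≡k

    EarlyRepeat : (ℕ → V) → ℕ → Set
    EarlyRepeat w m = ∃₂ λ x y → x < y × y < m × w x ≡ w y

    -- The closed walk starts and ends on the same side, so it passes k on the way out and again on the way back.
    repeat-from-side : ∀ {w m j} → Walk w m → Within S w m → w 0 ≡ w m → j ≤ m → Crossing (w 0) (w j) →
                       EarlyRepeat w m
    repeat-from-side {w} walk within w0≡wm j≤m crossing
      with x , _ , x<j , wx≡k ← cut-between walk within z≤n j≤m crossing
         | y , j<y , y<m , wy≡k ← cut-between walk within j≤m ≤-refl
                                   (subst (Crossing _) w0≡wm (Crossing-sym crossing))
      = x , y , <-trans x<j j<y , y<m , trans wx≡k (sym wy≡k)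

    repeat-from-cut : ∀ {w m a b} → Walk w m → Within S w m → w 0 ≡ k → a ≤ b → b ≤ m → Crossing (w a) (w b) →
                      EarlyRepeat w m
    repeat-from-cut walk within w0≡k a≤b b≤m crossing
      with x , a<x , x<b , wx≡k ← cut-between walk within a≤b b≤m crossing
      = 0 , x , ≤-<-trans z≤n a<x , <-≤-trans x<b b≤m , trans w0≡k (sym wx≡k)

    crossing-loop-repeats : ∀ {w m i j} → Walk w m → Within S w m → w 0 ≡ w m →
                            i ≤ m → w i ∈ A → j ≤ m → w j ∈ B → EarlyRepeat w m
    crossing-loop-repeats {w} {i = i} {j} walk within w0≡wm i≤m wi∈A j≤m wj∈B with cover (w 0) (within z≤n)
    ... | inj₁ w0∈A        = repeat-from-side walk within w0≡wm j≤m (inj₁ (w0∈A , wj∈B))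
    ... | inj₂ (inj₁ w0∈B) = repeat-from-side walk within w0≡wm i≤m (inj₂ (w0∈B , wi∈A))
    ... | inj₂ (inj₂ w0≡k) with ≤-total i j
    ...   | inj₁ i≤j = repeat-from-cut walk within w0≡k i≤j j≤m (inj₁ (wi∈A , wj∈B))
    ...   | inj₂ j≤i = repeat-from-cut walk within w0≡k j≤i i≤m (inj₂ (wj∈B , wi∈A))

    confine : ∀ {X Y : Subset n} {w m} → (∀ {x} → x ∈ S → x ∈ X ⊎ x ∈ Y ⊎ x ≡ k) → Within S w m →
              ¬ (∃ λ i → i < suc m × w i ∈ Y) → Within (X ∪ ⁅ k ⁆) w m
    confine {w = w} cover′ within avoids-Y {i} i≤m with cover′ (within i≤m)
    ... | inj₁ wi∈X        = ∈-∪⁅⁆ (inj₁ wi∈X)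
    ... | inj₂ (inj₁ wi∈Y) = ⊥-elim (avoids-Y (i , s≤s i≤m , wi∈Y))
    ... | inj₂ (inj₂ wi≡k) = ∈-∪⁅⁆ (inj₂ wi≡k)

    -- A closed walk avoiding B or A lies in a part; one meeting both repeats a vertex early, giving a shorter one.
    no-closed-geodesic : (∀ m → NoClosedGeodesic (A ∪ ⁅ k ⁆) m) → (∀ m → NoClosedGeodesic (B ∪ ⁅ k ⁆) m) →
                         ∀ m → NoClosedGeodesic S m
    no-closed-geodesic no-closed-A no-closed-B = <-rec (NoClosedGeodesic S) step
      where
      step : ∀ m → (∀ {l} → l < m → NoClosedGeodesic S l) → NoClosedGeodesic S m
      step m shorter {w} 0<m within lg w0≡wm
        with anyUpTo? (λ i → w i ∈? B) (suc m) | anyUpTo? (λ i → w i ∈? A) (suc m)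
      ... | no avoids-B | _ = no-closed-A m 0<m (confine (cover _) within avoids-B) lg w0≡wm
      ... | yes _ | no avoids-A =
        no-closed-B m 0<m (confine (swap-first-two ∘ cover _) within avoids-A) lg w0≡wm
      ... | yes (j , j<1+m , wj∈B) | yes (i , i<1+m , wi∈A)
        with x , y , x<y , y<m , wx≡wy ← crossing-loop-repeats (walk lg) within w0≡wm
                                           (s≤s⁻¹ i<1+m) wi∈A (s≤s⁻¹ j<1+m) wj∈B
        = closed-segment within lg x<y (<⇒≤ y<m) (shorter (≤-<-trans (m∸n≤m y x) y<m)) wx≡wy

    no-edge-across : ∀ {a b} → a ∈ A → b ∈ B → ¬ Adj G a b
    no-edge-across {a} {b} a∈A b∈B ab
      with sep a (b ∷ []) a∈A (A⊆S a a∈A ∷ B⊆S b b∈B ∷ []) (ab , tt) b∈B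
    ... | here refl         = k∉A a∈A
    ... | there (here refl) = k∉B b∈B

    crossing-midpoint : ∀ {a x b} → a ∈ A → b ∈ B → x ∈ S → Adj G a x → Adj G x b → x ≡ k
    crossing-midpoint {a} {x} {b} a∈A b∈B x∈S ax xb
      with sep a (x ∷ b ∷ []) a∈A (A⊆S a a∈A ∷ x∈S ∷ B⊆S b b∈B ∷ []) (ax , xb , tt) b∈B
    ... | here refl                 = ⊥-elim (k∉A a∈A)
    ... | there (here k≡x)          = sym k≡x
    ... | there (there (here refl)) = ⊥-elim (k∉B b∈B)

    module _ (chords-A : HasFourCycleChords (A ∪ ⁅ k ⁆)) (chords-B : HasFourCycleChords (B ∪ ⁅ k ⁆)) where

      chord-on-A-side : ∀ {a b c d} → b ∈ S → d ∈ S → FourCycle a b c d →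
                        a ∈ A ⊎ a ≡ k → c ∈ A ⊎ c ≡ k → Adj G a c
      chord-on-A-side b∈S d∈S cyc@(ab , bc , cd , da , a≢c , _) a-side c-side =
        chords-A (∈-∪⁅⁆ a-side) (neighbour b∈S ab bc) (∈-∪⁅⁆ c-side)
                 (neighbour d∈S (Adj-sym da) (Adj-sym cd)) cyc
        where
        neighbour : ∀ {z} → z ∈ S → Adj G _ z → Adj G z _ → z ∈ A ∪ ⁅ k ⁆
        neighbour z∈S = common-neighbour-on-side no-edge-across a-side c-side a≢c (cover _ z∈S)

      chord-on-B-side : ∀ {a b c d} → b ∈ S → d ∈ S → FourCycle a b c d →
                        a ∈ B ⊎ a ≡ k → c ∈ B ⊎ c ≡ k → Adj G a c
      chord-on-B-side b∈S d∈S cyc@(ab , bc , cd , da , a≢c , _) a-side c-side =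
        chords-B (∈-∪⁅⁆ a-side) (neighbour b∈S ab bc) (∈-∪⁅⁆ c-side)
                 (neighbour d∈S (Adj-sym da) (Adj-sym cd)) cyc
        where
        neighbour : ∀ {z} → z ∈ S → Adj G _ z → Adj G z _ → z ∈ B ∪ ⁅ k ⁆
        neighbour z∈S = common-neighbour-on-side (λ z∈B z∈A → no-edge-across z∈A z∈B ∘ Adj-sym)
                          a-side c-side a≢c (swap-first-two (cover _ z∈S))

      four-cycle-chords : HasFourCycleChords S
      four-cycle-chords {a} {b} {c} {d} a∈S b∈S c∈S d∈S cyc@(ab , bc , cd , da , a≢c , b≢d)
        with cover a a∈S | cover c c∈S
      ... | inj₁ a∈A        | inj₂ (inj₁ c∈B) =
        ⊥-elim (b≢d (trans (crossing-midpoint a∈A c∈B b∈S ab bc)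
                           (sym (crossing-midpoint a∈A c∈B d∈S (Adj-sym da) (Adj-sym cd)))))
      ... | inj₂ (inj₁ a∈B) | inj₁ c∈A        =
        ⊥-elim (b≢d (trans (crossing-midpoint c∈A a∈B b∈S (Adj-sym bc) (Adj-sym ab))
                           (sym (crossing-midpoint c∈A a∈B d∈S cd da))))
      ... | inj₁ a∈A        | inj₁ c∈A        = chord-on-A-side b∈S d∈S cyc (inj₁ a∈A) (inj₁ c∈A)
      ... | inj₁ a∈A        | inj₂ (inj₂ c≡k) = chord-on-A-side b∈S d∈S cyc (inj₁ a∈A) (inj₂ c≡k)
      ... | inj₂ (inj₂ a≡k) | inj₁ c∈A        = chord-on-A-side b∈S d∈S cyc (inj₂ a≡k) (inj₁ c∈A)
      ... | inj₂ (inj₂ a≡k) | inj₂ (inj₂ c≡k) = chord-on-A-side b∈S d∈S cyc (inj₂ a≡k) (inj₂ c≡k)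
      ... | inj₂ (inj₁ a∈B) | inj₂ (inj₁ c∈B) = chord-on-B-side b∈S d∈S cyc (inj₁ a∈B) (inj₁ c∈B)
      ... | inj₂ (inj₁ a∈B) | inj₂ (inj₂ c≡k) = chord-on-B-side b∈S d∈S cyc (inj₁ a∈B) (inj₂ c≡k)
      ... | inj₂ (inj₂ a≡k) | inj₂ (inj₁ c∈B) = chord-on-B-side b∈S d∈S cyc (inj₂ a≡k) (inj₁ c∈B)

  block⇒no-closed-geodesic : ∀ {S} → BlockOn G S → ∀ m → NoClosedGeodesic S m
  part⇒no-closed-geodesic : ∀ {S} → CompleteOn G S ⊎ BlockOn G S → ∀ m → NoClosedGeodesic S m
  part⇒no-closed-geodesic (inj₁ K) = complete⇒no-closed-geodesic K
  part⇒no-closed-geodesic (inj₂ β) = block⇒no-closed-geodesic β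
  block⇒no-closed-geodesic (block S A B k cover A⊆S B⊆S _ k∉A k∉B _ sep partA partB) =
    Separated.no-closed-geodesic cover A⊆S B⊆S k∉A k∉B sep
      (part⇒no-closed-geodesic partA) (part⇒no-closed-geodesic partB)

  block⇒four-cycle-chords : ∀ {S} → BlockOn G S → HasFourCycleChords S
  part⇒four-cycle-chords : ∀ {S} → CompleteOn G S ⊎ BlockOn G S → HasFourCycleChords S
  part⇒four-cycle-chords (inj₁ K) a∈S _ c∈S _ (_ , _ , _ , _ , a≢c , _) = K _ _ a∈S c∈S a≢c
  part⇒four-cycle-chords (inj₂ β) = block⇒four-cycle-chords β
  block⇒four-cycle-chords (block S A B k cover A⊆S B⊆S _ k∉A k∉B _ sep partA partB) =
    Separated.four-cycle-chords cover A⊆S B⊆S k∉A k∉B sep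
      (part⇒four-cycle-chords partA) (part⇒four-cycle-chords partB)

  module _ (β : IsBlockGraph G) where

    four-cycle-chord : ∀ {a b c d} → FourCycle a b c d → Adj G a c
    four-cycle-chord = block⇒four-cycle-chords β ∈⊤ ∈⊤ ∈⊤ ∈⊤

    -- An edge a d would close the 4-cycle a b c d, whose chord a c is excluded.
    far-across-triangle : ∀ {a b c d} → Adj G a b → Adj G b c → Dist≥2 a c →
                          Adj G d b → Adj G d c → d ≢ b → Dist≥2 a d
    far-across-triangle ab bc (a≢c , ¬ac) db dc d≢b = a≢d , ¬ad
      where
      a≢d : _ ≢ _
      a≢d refl = ¬ac dc
      ¬ad : ¬ Adj G _ _
      ¬ad ad = ¬ac (four-cycle-chord (ab , bc , Adj-sym dc , Adj-sym ad , a≢c , d≢b ∘ sym))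

    -- Pigeonhole: the infinite walk repeats a vertex within its first n + 1 positions.
    no-infinite-geodesic : ∀ w → (∀ i → GeodesicStep w i) → ⊥
    no-infinite-geodesic w steps with i , j , i<j , wi≡wj ← Fin.pigeonhole (n<1+n n) (w ∘ toℕ)
      = closed-segment (λ _ → ∈⊤) (everywhere-geodesic steps (toℕ j)) i<j ≤-refl
          (block⇒no-closed-geodesic β _) wi≡wj

  module Automorphism (σ : Permutation′ n) (aut : IsAut G σ) where

    Adj-σ : ∀ {x y} → Adj G x y → Adj G (σ ⟨$⟩ʳ x) (σ ⟨$⟩ʳ y)
    Adj-σ {x} {y} xy = trans (proj₁ aut x y) xy

    Adj-σ⁻¹ : ∀ {x y} → Adj G (σ ⟨$⟩ʳ x) (σ ⟨$⟩ʳ y) → Adj G x y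
    Adj-σ⁻¹ {x} {y} σxσy = trans (sym (proj₁ aut x y)) σxσy

    σ-injective : ∀ {x y} → σ ⟨$⟩ʳ x ≡ σ ⟨$⟩ʳ y → x ≡ y
    σ-injective eq = trans (sym (inverseˡ σ)) (trans (cong (σ ⟨$⟩ˡ_) eq) (inverseˡ σ))

    Dist≥2-σ : ∀ {x y} → Dist≥2 x y → Dist≥2 (σ ⟨$⟩ʳ x) (σ ⟨$⟩ʳ y)
    Dist≥2-σ (x≢y , ¬xy) = x≢y ∘ σ-injective , ¬xy ∘ Adj-σ⁻¹

    Twisted : ℕ → (ℕ → V) → Set
    Twisted L w = ∀ m → w (m + L) ≡ σ ⟨$⟩ʳ w m

    GeodesicStep-twisted : ∀ {L w} → Twisted L w → ∀ {i} → GeodesicStep w i → GeodesicStep w (i + L)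
    GeodesicStep-twisted {L} {w} twisted {i} (adj , far) =
      GeodesicStep-from w (i + L) (twisted i) (twisted (suc i)) (twisted (2 + i)) (Adj-σ adj , Dist≥2-σ far)

    twisted-geodesic : ∀ {L w} → 0 < L → Twisted L w → (∀ {i} → i < L → GeodesicStep w i) →
                       ∀ i → GeodesicStep w i
    twisted-geodesic {L} {w} 0<L twisted first-period = <-rec (GeodesicStep w) step
      where
      step : ∀ i → (∀ {j} → j < i → GeodesicStep w j) → GeodesicStep w i
      step i earlier with i <? L
      ... | yes i<L = first-period i<L
      ... | no i≮L  = subst (GeodesicStep w) (m∸n+n≡m L≤i)
                        (GeodesicStep-twisted twisted (earlier (∸-monoʳ-< 0<L L≤i)))
        where L≤i = ≮⇒≥ i≮L

    -- The walk f 0, …, f (L - 1), σ (f 0), …, σ (f (L - 1)), σ² (f 0), …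
    twist : (L : ℕ) .{{_ : NonZero L}} → (ℕ → V) → ℕ → V
    twist L f m = fold (f (m % L)) (σ ⟨$⟩ʳ_) (m / L)

    twist-below : ∀ L .{{_ : NonZero L}} f {m} → m < L → twist L f m ≡ f m
    twist-below L f m<L = cong₂ (λ r q → fold (f r) (σ ⟨$⟩ʳ_) q) (m<n⇒m%n≡m m<L) (m<n⇒m/n≡0 m<L)

    twist-twisted : ∀ L .{{_ : NonZero L}} f → Twisted L (twist L f)
    twist-twisted L f m = cong₂ (λ r q → fold (f r) (σ ⟨$⟩ʳ_) q) ([m+n]%n≡m%n m L)
      (trans (m/n≡1+[m∸n]/n (m≤n+m L m)) (cong (λ k → suc (k / L)) (m+n∸n≡m m L)))

    module _ (β : IsBlockGraph G) where

      no-twisted-geodesic : ∀ L .{{_ : NonZero L}} f → (∀ {i} → i < L → GeodesicStep (twist L f) i) → ⊥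
      no-twisted-geodesic L f first-period = no-infinite-geodesic β (twist L f)
        (twisted-geodesic (>-nonZero⁻¹ L) (twist-twisted L f) first-period)

      straight-junction⇒⊥ : ∀ E {p} → LocallyGeodesic p (2 + E) → p (2 + E) ≡ σ ⟨$⟩ʳ p 0 →
                            Dist≥2 (p (1 + E)) (σ ⟨$⟩ʳ p 1) → ⊥
      straight-junction⇒⊥ E {p} lg end far = no-twisted-geodesic (2 + E) p steps
        where
        w = twist (2 + E) p
        w≡p : ∀ {m} → m ≤ 2 + E → w m ≡ p m
        w≡p m≤2+E with m≤n⇒m<n∨m≡n m≤2+E
        ... | inj₁ m<2+E = twist-below (2 + E) p m<2+E
        ... | inj₂ refl  = trans (twist-twisted (2 + E) p 0) (trans (cong (σ ⟨$⟩ʳ_) (twist-below (2 + E) p z<s)) (sym end))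
        steps : ∀ {i} → i < 2 + E → GeodesicStep w i
        steps {i} i<2+E with m<1+n⇒m<n∨m≡n i<2+E
        ... | inj₁ i<1+E = GeodesicStep-from w i (w≡p (≤-trans (n≤1+n i) 1+i≤2+E)) (w≡p 1+i≤2+E) (w≡p (s≤s i<1+E))
                             (geodesic-step lg (s≤s i<1+E))
          where 1+i≤2+E = ≤-trans (n≤1+n (suc i)) (s≤s i<1+E)
        ... | inj₂ refl  = GeodesicStep-from w (suc E) (w≡p (n≤1+n _)) (w≡p ≤-refl)
                             (trans (twist-twisted (2 + E) p 1) (cong (σ ⟨$⟩ʳ_) (twist-below (2 + E) p (s<s z<s))))
                             (walk lg ≤-refl , far)

      module TriangleJunction (E : ℕ) {p : ℕ → V} (lg : LocallyGeodesic p (2 + E))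
                              (end : p (2 + E) ≡ σ ⟨$⟩ʳ p 0) (σp₁≢p₁₊E : σ ⟨$⟩ʳ p 1 ≢ p (1 + E))
                              (p₁₊E~σp₁ : Adj G (p (1 + E)) (σ ⟨$⟩ʳ p 1)) where

        w : ℕ → V
        w = twist (1 + E) (p ∘ suc)

        w-below : ∀ {m} → m < 1 + E → w m ≡ p (suc m)
        w-below = twist-below (1 + E) (p ∘ suc)

        w-junction : w (1 + E) ≡ σ ⟨$⟩ʳ p 1
        w-junction = trans (twist-twisted (1 + E) (p ∘ suc) 0) (cong (σ ⟨$⟩ʳ_) (w-below z<s))

        p₁₊E~σp₀ : Adj G (p (1 + E)) (σ ⟨$⟩ʳ p 0)
        p₁₊E~σp₀ = subst (Adj G (p (1 + E))) end (walk lg ≤-refl)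

        far-before : Dist≥2 (p E) (σ ⟨$⟩ʳ p 1)
        far-before = far-across-triangle β (walk lg (n≤1+n _)) (walk lg ≤-refl) (no-shortcut lg ≤-refl)
                       (Adj-sym p₁₊E~σp₁) σp₁~p₂₊E σp₁≢p₁₊E
          where
          σp₁~p₂₊E = subst (Adj G (σ ⟨$⟩ʳ p 1)) (sym end) (Adj-σ (Adj-sym (walk lg z<s)))

        far-after : Dist≥2 (p (1 + E)) (σ ⟨$⟩ʳ p 2)
        far-after = Dist≥2-sym (far-across-triangle β (Adj-σ (Adj-sym (walk lg (s<s z<s))))
                      (Adj-σ (Adj-sym (walk lg z<s))) (Dist≥2-σ (Dist≥2-sym (no-shortcut lg (s≤s (s≤s z≤n)))))
                      p₁₊E~σp₁ p₁₊E~σp₀ (σp₁≢p₁₊E ∘ sym))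

      last-junction-step : ∀ E {p} lg end σp₁≢p₁₊E p₁₊E~σp₁ →
                           GeodesicStep (TriangleJunction.w E {p} lg end σp₁≢p₁₊E p₁₊E~σp₁) E
      last-junction-step zero {p} lg end σp₁≢p₁ p₁~σp₁ =
        GeodesicStep-from w 0 (w-below z<s) w-junction (trans (twist-twisted 1 (p ∘ suc) 1) (cong (σ ⟨$⟩ʳ_) w-junction))
          (p₁~σp₁ , far-across-triangle β p₁~σp₁ (Adj-σ (walk lg (s<s z<s))) far-after
                      (Adj-σ (Adj-sym p₁~σp₁)) σ²p₁~σp₂ (σp₁≢p₁ ∘ σ-injective))
        where
        open TriangleJunction zero lg end σp₁≢p₁ p₁~σp₁
        σ²p₁~σp₂ : Adj G (σ ⟨$⟩ʳ (σ ⟨$⟩ʳ p 1)) (σ ⟨$⟩ʳ p 2)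
        σ²p₁~σp₂ = subst (λ x → Adj G (σ ⟨$⟩ʳ (σ ⟨$⟩ʳ p 1)) (σ ⟨$⟩ʳ x)) (sym end)
                     (Adj-σ (Adj-σ (Adj-sym (walk lg z<s))))
      last-junction-step (suc E) {p} lg end σp₁≢p₁₊E p₁₊E~σp₁ =
        GeodesicStep-from w (suc E) (w-below ≤-refl) w-junction
          (trans (twist-twisted (2 + E) (p ∘ suc) 1) (cong (σ ⟨$⟩ʳ_) (w-below (s<s z<s))))
          (p₁₊E~σp₁ , far-after)
        where open TriangleJunction (suc E) lg end σp₁≢p₁₊E p₁₊E~σp₁

      triangle-junction⇒⊥ : ∀ E {p} → LocallyGeodesic p (2 + E) → p (2 + E) ≡ σ ⟨$⟩ʳ p 0 →
                            σ ⟨$⟩ʳ p 1 ≢ p (1 + E) → Adj G (p (1 + E)) (σ ⟨$⟩ʳ p 1) → ⊥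
      triangle-junction⇒⊥ E {p} lg end σp₁≢p₁₊E p₁₊E~σp₁ = no-twisted-geodesic (1 + E) (p ∘ suc) steps
        where
        open TriangleJunction E lg end σp₁≢p₁₊E p₁₊E~σp₁
        steps : ∀ {i} → i < 1 + E → GeodesicStep w i
        steps {i} i<1+E with m<1+n⇒m<n∨m≡n i<1+E
        ... | inj₂ refl = last-junction-step E lg end σp₁≢p₁₊E p₁₊E~σp₁
        ... | inj₁ i<E with m≤n⇒m<n∨m≡n i<E
        ...   | inj₁ 1+i<E = GeodesicStep-from w i (w-below i<1+E) (w-below (s≤s i<E))
                               (w-below (s≤s 1+i<E)) (geodesic-step lg (s≤s (s≤s i<E)))
        ...   | inj₂ refl  = GeodesicStep-from w i (w-below (n≤1+n _)) (w-below ≤-refl) w-junction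
                               (walk lg (n≤1+n _) , far-before)

      σ-second≡penultimate : ∀ E {p} → LocallyGeodesic p (2 + E) → p (2 + E) ≡ σ ⟨$⟩ʳ p 0 →
                              σ ⟨$⟩ʳ p 1 ≡ p (1 + E)
      σ-second≡penultimate E {p} lg end with σ ⟨$⟩ʳ p 1 Fin.≟ p (1 + E)
      ... | yes flips = flips
      ... | no σp₁≢p₁₊E with Adj? (p (1 + E)) (σ ⟨$⟩ʳ p 1)
      ...   | yes p₁₊E~σp₁ = ⊥-elim (triangle-junction⇒⊥ E lg end σp₁≢p₁₊E p₁₊E~σp₁)
      ...   | no ¬p₁₊E~σp₁ = ⊥-elim (straight-junction⇒⊥ E lg end (σp₁≢p₁₊E ∘ sym , ¬p₁₊E~σp₁))

      σ-reverses : ∀ D {p} → LocallyGeodesic p D → p D ≡ σ ⟨$⟩ʳ p 0 →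
                   ∀ {i} → i + i ≤ D → σ ⟨$⟩ʳ p i ≡ p (D ∸ i)
      σ-reverses D lg end {zero} _ = sym end
      σ-reverses (suc zero) lg end {suc i} (s≤s i+1+i≤0) = ⊥-elim (n≮0 (subst (_≤ 0) (+-suc i i) i+1+i≤0))
      σ-reverses (suc (suc E)) {p} lg end {suc i} (s≤s i+1+i≤1+E) = begin
        σ ⟨$⟩ʳ p (suc i)  ≡⟨ σ-reverses E (LocallyGeodesic-drop 1 (n≤1+n _) lg)
                                (sym (σ-second≡penultimate E lg end)) i+i≤E ⟩
        p (suc (E ∸ i))    ≡⟨ cong p (sym (+-∸-assoc 1 (≤-trans (m≤m+n i i) i+i≤E))) ⟩
        p (suc E ∸ i)      ∎
        where
        open ≡-Reasoning
        i+i≤E = s≤s⁻¹ (subst (_≤ suc E) (+-suc i i) i+1+i≤1+E)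

      module _ {u v rest} (shortest : IsShortestPath G u v rest) (σu≡v : σ ⟨$⟩ʳ u ≡ v) where

        private
          p = walkVertex u rest
          D = length rest
          lg = shortest⇒geodesic shortest

        σ-reverses-shortest : ∀ {i} → i + i ≤ D → σ ⟨$⟩ʳ p i ≡ p (D ∸ i)
        σ-reverses-shortest {i} = σ-reverses D lg end {i}
          where end = trans (sym (lastOf-walkVertex u rest)) (trans (proj₂ (proj₁ shortest)) (sym σu≡v))

        vertexColors-palindrome : Palindrome (vertexColors G (u ∷ rest))
        vertexColors-palindrome =
          subst Palindrome (sym as-applyUpTo) (applyUpTo-palindrome (vcol G ∘ p) (suc D) mirror)
          where
          as-applyUpTo : vertexColors G (u ∷ rest) ≡ applyUpTo (vcol G ∘ p) (suc D)
          as-applyUpTo = trans (cong (map (vcol G)) (applyUpTo-walkVertex u rest))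
                               (map-applyUpTo p (vcol G) (suc D))
          mirror : ∀ {i} → i < D ∸ i → vcol G (p (D ∸ i)) ≡ vcol G (p i)
          mirror {i} i<D∸i = trans (cong (vcol G) (sym (σ-reverses-shortest {i} (<⇒≤ (m<o∸n⇒m+n<o i<D∸i)))))
                                   (proj₁ (proj₂ aut) (p i))

        edgeColors-palindrome : Palindrome (edgeColors G (u ∷ rest))
        edgeColors-palindrome = subst Palindrome (sym as-applyUpTo) (applyUpTo-palindrome edgeColor D mirror)
          where
          edgeColor : ℕ → ℕ
          edgeColor i = ecol G (p i) (p (suc i))
          as-applyUpTo : edgeColors G (u ∷ rest) ≡ applyUpTo edgeColor D
          as-applyUpTo = trans (cong (edgeColors G) (applyUpTo-walkVertex u rest)) (edgeColors-applyUpTo p D)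
          mirror : ∀ {i} → i < D ∸ suc i → edgeColor (D ∸ suc i) ≡ edgeColor i
          mirror {i} i<D∸1+i = begin
            ecol G (p (D ∸ suc i)) (p (suc (D ∸ suc i)))
              ≡⟨ cong (ecol G (p (D ∸ suc i)) ∘ p) (sym (+-∸-assoc 1 i<D)) ⟩
            ecol G (p (D ∸ suc i)) (p (D ∸ i))
              ≡⟨ cong₂ (ecol G) (sym (σ-reverses-shortest {suc i} 2+2i≤D)) (sym (σ-reverses-shortest {i} 2i≤D)) ⟩
            ecol G (σ ⟨$⟩ʳ p (suc i)) (σ ⟨$⟩ʳ p i)
              ≡⟨ ecol-sym G _ _ ⟩
            ecol G (σ ⟨$⟩ʳ p i) (σ ⟨$⟩ʳ p (suc i))
              ≡⟨ proj₂ (proj₂ aut) _ _ (walk lg i<D) ⟩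
            ecol G (p i) (p (suc i))
              ∎
            where
            open ≡-Reasoning
            2+2i≤D : suc i + suc i ≤ D
            2+2i≤D = m<o∸n⇒m+n<o i<D∸1+i
            2i≤D = ≤-trans (+-mono-≤ (n≤1+n i) (n≤1+n i)) 2+2i≤D
            i<D = ≤-trans (m≤m+n (suc i) (suc i)) 2+2i≤D

lemma4p3 : (n : ℕ) (G : ColoredGraph n) → IsBlockGraph G → Connected G → IsRCOP G →
    (u v : Fin n) (rest : List (Fin n)) → vcol G u ≡ vcol G v →
    IsShortestPath G u v rest →
    Palindrome (edgeColors G (u ∷ rest)) × Palindrome (vertexColors G (u ∷ rest))
lemma4p3 n G β _ (_ , vertex-transitive , _) u v rest u~v shortest
  with σ , aut , σu≡v ← vertex-transitive u v u~v
  = edgeColors-palindrome β shortest σu≡v , vertexColors-palindrome β shortest σu≡v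
  where open Automorphism G σ aut
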